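{- If $G$ is a weakly universal graph, then $G$ contains an induced subgraph isomorphic to $\mathcal U_{\mathrm{fin}}$ or an induced subgraph isomorphic to the complement of $\mathcal U_{\mathrm{fin}}$.
   Context: A graph is weakly universal if it contains every finite graph as an induced subgraph (up to isomorphism). For graphs $H_i$ ($i\in I$), the isolated union $\sum_{i\in I}H_i$ is the disjoint union of the $H_i$ with no edges between different $H_i$. $\mathcal U_{\mathrm{fin}}=\sum_{i<\omega}H_i$, where $(H_i)_{i<\omega}$ is a list of finite graphs in which every finite graph appears, up to isomorphism, infinitely often. The complement of a graph $(V,E)$ is $(V,[V]^2\setminus E)$. -}

module Defs where

open import Data.Nat using (ℕ; _≤_)
open import Data.Fin using (Fin)
open import Data.Product using (Σ; ∃; _×_; _,_)
open import Data.Empty using (⊥)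
open import Relation.Nullary using (¬_)
open import Relation.Binary.PropositionalEquality using (_≡_; _≢_)
open import Function.Bundles using (_⇔_)
open import Function.Definitions using (Injective; Surjective)

record Graph (V : Set) : Set₁ where
  field
    Edge   : V → V → Set
    sym    : ∀ {x y} → Edge x y → Edge y x
    irrefl : ∀ {x} → ¬ Edge x x
open Graph public

-- A finite graph: a graph on Fin n (every finite graph is isomorphic to one).
FinGraph : ℕ → Set₁
FinGraph n = Graph (Fin n)

-- Induced embedding of H into G: an injective vertex map preserving
-- adjacency and non-adjacency.  "G contains an induced subgraph
-- isomorphic to H" means such an embedding exists.
record InducedEmbedding {V W : Set} (H : Graph V) (G : Graph W) : Set₁ where
  field
    map       : V → W
    injective : Injective _≡_ _≡_ map
    edges     : ∀ x y → Edge H x y ⇔ Edge G (map x) (map y)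
open InducedEmbedding public

record Iso {V W : Set} (H : Graph V) (G : Graph W) : Set₁ where
  field
    emb        : InducedEmbedding H G
    surjective : Surjective _≡_ _≡_ (map emb)

WeaklyUniversal : {W : Set} → Graph W → Set₁
WeaklyUniversal G = ∀ n (F : FinGraph n) → InducedEmbedding F G

data CoEdge {V : Set} (G : Graph V) (x y : V) : Set where
  coEdge : x ≢ y → ¬ Edge G x y → CoEdge G x y

Complement : {V : Set} → Graph V → Graph V
Complement G = record
  { Edge   = CoEdge G
  ; sym    = λ { (coEdge ne nE) → coEdge (λ p → ne (symm p)) (λ e → nE (Graph.sym G e)) }
  ; irrefl = λ { (coEdge ne _) → ne reflx }
  }
  where
  open import Relation.Binary.PropositionalEquality using () renaming (sym to symm; refl to reflx)

IUVertex : (s : ℕ → ℕ) → Set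
IUVertex s = Σ ℕ (λ i → Fin (s i))

data IUEdge (s : ℕ → ℕ) (H : (i : ℕ) → FinGraph (s i)) : IUVertex s → IUVertex s → Set where
  inside : ∀ {i x y} → Edge (H i) x y → IUEdge s H (i , x) (i , y)

IsolatedUnion : (s : ℕ → ℕ) (H : (i : ℕ) → FinGraph (s i)) → Graph (IUVertex s)
IsolatedUnion s H = record
  { Edge   = IUEdge s H
  ; sym    = λ { (inside {i} e) → inside (Graph.sym (H i) e) }
  ; irrefl = λ { (inside {i} e) → Graph.irrefl (H i) e }
  }

ListsAllFinGraphsInfinitelyOften : (s : ℕ → ℕ) (H : (i : ℕ) → FinGraph (s i)) → Set₁
ListsAllFinGraphsInfinitelyOften s H =
  ∀ n (F : FinGraph n) (m : ℕ) → Σ ℕ (λ i → (m ≤ i) × Iso (H i) F)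

{-# OPTIONS --safe #-}
module Submission where

-- Call a set S of vertices of G universal if every finite graph embeds into S. If S is universal
-- then so is S ∩ P or S ∖ P, for any P: otherwise there are counterexamples A and B, and a copy
-- of the lexicographic product A[B] in S either has a block (a copy of B) outside P or meets P
-- in every block (giving a copy of A inside P). Consequently a universal S can be shrunk to a
-- universal T ⊆ S to which each of finitely many given vertices is completely joined or
-- completely separated; applying the same dichotomy to a copy of A[A] yields a copy of A in S
-- that as a whole is joined or separated from such a T. Iterating along the graphs
-- H₀ ⊕ coH₀ ⊕ ⋯ ⊕ Hₖ ⊕ coHₖ gives copies each uniformly linked to all later ones, and a
-- subsequence of constant colour assembles into the isolated union (all separated) or its
-- complement (all joined).

open import Defs
open import Level using (0ℓ)
open import Axiom.ExcludedMiddle using (ExcludedMiddle)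
open import Data.Bool using (Bool; true; false; if_then_else_)
open import Data.Empty using (⊥-elim)
open import Data.Fin using (Fin; zero; suc; combine; remQuot; splitAt; _↑ˡ_; _↑ʳ_)
open import Data.Fin.Properties
  using (remQuot-combine; combine-injectiveˡ; combine-injectiveʳ; splitAt-↑ˡ; splitAt-↑ʳ;
         ↑ˡ-injective; ↑ʳ-injective; 0≢1+n)
  renaming (_≟_ to _≟ᶠ_)
open import Data.Nat using (ℕ; zero; suc; _+_; _*_; _≤_; _<_; _≤′_; ≤′-refl; ≤′-step; z≤n; s≤s)
open import Data.Nat.Properties using (_≟_; <-cmp; <-trans; ≤-trans; m≤m+n; m≤n+m; n<1+n; ≤⇒≤′)
open import Data.Product using (∃; ∃₂; _×_; _,_; proj₁; proj₂; map₂)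
open import Data.Sum using (_⊎_; inj₁; inj₂; [_,_]; fromInj₁; fromInj₂)
open import Data.Unit using (⊤; tt)
open import Function using (_∘_; id; const; _∋_)
open import Function.Bundles using (_⇔_; mk⇔; Equivalence)
open import Function.Construct.Composition using (_⇔-∘_)
open import Function.Definitions using (Injective)
open import Relation.Binary.Core using (_Preserves_⟶_)
open import Relation.Binary.Definitions using (tri<; tri≈; tri>)
import Relation.Binary.PropositionalEquality as ≡
open ≡ using (_≡_; _≢_; refl; cong; cong₂; subst)
open import Relation.Nullary using (¬_; Dec; yes; no; does)
open import Relation.Nullary.Decidable using (dec-true; dec-false; does-⇔; decidable-stable)
open import Relation.Nullary.Negation using (¬∃⟶∀¬)
open import Relation.Unary using (Pred; U; ∁; _∩_; _⊆_; ｛_｝)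

private
  variable
    m n N : ℕ

⇔-does : {P : Set} (P? : Dec P) → P ⇔ does P? ≡ true
⇔-does (yes p) = mk⇔ (const refl) (const p)
⇔-does (no ¬p) = mk⇔ (⊥-elim ∘ ¬p) (λ ())

true⊎false : (b : Bool) → b ≡ true ⊎ b ≡ false
true⊎false true  = inj₁ refl
true⊎false false = inj₂ refl

-- Finite graphs are coded by Boolean matrices (whose diagonal is ignored) rather than by
-- FinGraph, which lives in Set₁: universality must be a proposition in Set for
-- ExcludedMiddle 0ℓ to decide it.
record AdjMatrix : Set where
  field
    size    : ℕ
    adj     : Fin size → Fin size → Bool
    adj-sym : ∀ x y → adj x y ≡ adj y x
open AdjMatrix

private
  variable
    A B C : AdjMatrix

infix 4 _⊑_
record _⊑_ (A B : AdjMatrix) : Set where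
  field
    pos           : Fin (size A) → Fin (size B)
    pos-injective : Injective _≡_ _≡_ pos
    adj-pos       : ∀ {x y} → x ≢ y → adj B (pos x) (pos y) ≡ adj A x y
open _⊑_

⊑-refl : A ⊑ A
⊑-refl = record { pos = id ; pos-injective = id ; adj-pos = λ _ → refl }

⊑-trans : A ⊑ B → B ⊑ C → A ⊑ C
⊑-trans e f = record
  { pos           = pos f ∘ pos e
  ; pos-injective = λ eq → pos-injective e (pos-injective f eq)
  ; adj-pos       = λ x≢y → ≡.trans (adj-pos f (x≢y ∘ pos-injective e)) (adj-pos e x≢y)
  }

graphOf : (A : AdjMatrix) → FinGraph (size A)
graphOf A = record
  { Edge   = λ x y → x ≢ y × adj A x y ≡ true
  ; sym    = λ (x≢y , a) → x≢y ∘ ≡.sym , ≡.trans (adj-sym A _ _) a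
  ; irrefl = λ (x≢x , _) → x≢x refl
  }

edgeless : ℕ → AdjMatrix
edgeless n = record { size = n ; adj = λ _ _ → false ; adj-sym = λ _ _ → refl }

private
  sumAdj : (Fin m → Fin m → Bool) → (Fin n → Fin n → Bool) → Fin m ⊎ Fin n → Fin m ⊎ Fin n → Bool
  sumAdj a b (inj₁ x) (inj₁ y) = a x y
  sumAdj a b (inj₂ x) (inj₂ y) = b x y
  sumAdj a b _        _        = false

  sumAdj-sym : {a : Fin m → Fin m → Bool} {b : Fin n → Fin n → Bool} →
               (∀ x y → a x y ≡ a y x) → (∀ x y → b x y ≡ b y x) →
               ∀ u v → sumAdj a b u v ≡ sumAdj a b v u
  sumAdj-sym a-sym b-sym (inj₁ x) (inj₁ y) = a-sym x y
  sumAdj-sym a-sym b-sym (inj₂ x) (inj₂ y) = b-sym x y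
  sumAdj-sym a-sym b-sym (inj₁ _) (inj₂ _) = refl
  sumAdj-sym a-sym b-sym (inj₂ _) (inj₁ _) = refl

infixl 6 _⊕_
_⊕_ : AdjMatrix → AdjMatrix → AdjMatrix
A ⊕ B = record
  { size    = size A + size B
  ; adj     = λ x y → sumAdj (adj A) (adj B) (splitAt (size A) x) (splitAt (size A) y)
  ; adj-sym = λ x y → sumAdj-sym (adj-sym A) (adj-sym B) (splitAt (size A) x) (splitAt (size A) y)
  }

⊕-left : A ⊑ A ⊕ B
⊕-left {A} {B} = record
  { pos           = _↑ˡ size B
  ; pos-injective = ↑ˡ-injective (size B) _ _
  ; adj-pos       = λ {x} {y} _ → cong₂ (sumAdj (adj A) (adj B))
                                        (splitAt-↑ˡ (size A) x (size B))
                                        (splitAt-↑ˡ (size A) y (size B))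
  }

⊕-right : B ⊑ A ⊕ B
⊕-right {B} {A} = record
  { pos           = size A ↑ʳ_
  ; pos-injective = ↑ʳ-injective (size A) _ _
  ; adj-pos       = λ {x} {y} _ → cong₂ (sumAdj (adj A) (adj B))
                                        (splitAt-↑ʳ (size A) (size B) x)
                                        (splitAt-↑ʳ (size A) (size B) y)
  }

private
  lexAdj : (A B : AdjMatrix) → Fin (size A) × Fin (size B) → Fin (size A) × Fin (size B) → Bool
  lexAdj A B (i , j) (i′ , j′) = if does (i ≟ᶠ i′) then adj B j j′ else adj A i i′

  lexAdj-sym : (A B : AdjMatrix) → ∀ u v → lexAdj A B u v ≡ lexAdj A B v u
  lexAdj-sym A B (i , j) (i′ , j′)
    rewrite does-⇔ (mk⇔ ≡.sym ≡.sym) (i ≟ᶠ i′) (i′ ≟ᶠ i) | adj-sym A i i′ | adj-sym B j j′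
    = refl

_[_] : AdjMatrix → AdjMatrix → AdjMatrix
A [ B ] = record
  { size    = size A * size B
  ; adj     = λ k l → lexAdj A B (remQuot (size B) k) (remQuot (size B) l)
  ; adj-sym = λ k l → lexAdj-sym A B (remQuot (size B) k) (remQuot (size B) l)
  }

private
  adj-combine : (A B : AdjMatrix) → ∀ i j i′ j′ →
                adj (A [ B ]) (combine i j) (combine i′ j′) ≡ lexAdj A B (i , j) (i′ , j′)
  adj-combine A B i j i′ j′ = cong₂ (lexAdj A B) (remQuot-combine i j) (remQuot-combine i′ j′)

block : Fin (size A) → B ⊑ A [ B ]
block {A} {B} i = record
  { pos           = combine i
  ; pos-injective = combine-injectiveʳ i _ i _
  ; adj-pos       = λ {j} {j′} _ →
      ≡.trans (adj-combine A B i j i j′)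
              (cong (if_then adj B j j′ else adj A i i) (dec-true (i ≟ᶠ i) refl))
  }

transversal : (Fin (size A) → Fin (size B)) → A ⊑ A [ B ]
transversal {A} {B} c = record
  { pos           = λ i → combine i (c i)
  ; pos-injective = combine-injectiveˡ _ _ _ _
  ; adj-pos       = λ {i} {i′} i≢i′ →
      ≡.trans (adj-combine A B i (c i) i′ (c i′))
              (cong (if_then adj B (c i) (c i′) else adj A i i′) (dec-false (i ≟ᶠ i′) i≢i′))
  }

partialSum : (ℕ → AdjMatrix) → ℕ → AdjMatrix
partialSum A zero    = A zero
partialSum A (suc k) = partialSum A k ⊕ A (suc k)

summand⊑partialSum : (A : ℕ → AdjMatrix) → ∀ k → A k ⊑ partialSum A k
summand⊑partialSum A zero    = ⊑-refl
summand⊑partialSum A (suc k) = ⊕-right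

partialSum-mono : (A : ℕ → AdjMatrix) → ∀ {j k} → j ≤′ k → partialSum A j ⊑ partialSum A k
partialSum-mono A ≤′-refl         = ⊑-refl
partialSum-mono A (≤′-step j≤′k) = ⊑-trans (partialSum-mono A j≤′k) ⊕-left

InfinitelyOften : Pred ℕ 0ℓ → Set
InfinitelyOften P = ∀ m → ∃ λ k → m ≤ k × P k

increasing-step : {K : ℕ → ℕ} → (∀ j → K j < K (suc j)) → K Preserves _<_ ⟶ _<_
increasing-step {K} K-step i<j = go (≤⇒≤′ i<j)
  where
  go : ∀ {i j} → suc i ≤′ j → K i < K j
  go ≤′-refl         = K-step _
  go (≤′-step i<′j) = <-trans (go i<′j) (K-step _)

increasing⇒inflationary : {K : ℕ → ℕ} → K Preserves _<_ ⟶ _<_ → ∀ j → j ≤ K j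
increasing⇒inflationary K↑ zero    = z≤n
increasing⇒inflationary K↑ (suc j) = ≤-trans (s≤s (increasing⇒inflationary K↑ j)) (K↑ (n<1+n j))

subsequence : {P : Pred ℕ 0ℓ} → InfinitelyOften P →
              ∃ λ K → K Preserves _<_ ⟶ _<_ × ∀ j → P (K j)
subsequence {P} inf = K , increasing-step (λ j → proj₁ (proj₂ (inf (suc (K j))))) , P-K
  where
  K : ℕ → ℕ
  K zero    = proj₁ (inf zero)
  K (suc j) = proj₁ (inf (suc (K j)))

  P-K : ∀ j → P (K j)
  P-K zero    = proj₂ (proj₂ (inf zero))
  P-K (suc j) = proj₂ (proj₂ (inf (suc (K j))))

module _ {W : Set} {G : Graph W} {s : ℕ → ℕ} {H : (j : ℕ) → FinGraph (s j)} where

  private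
    across : {R : W → W → Set} → (∀ {v w} → R v w → R w v) → (f : ∀ j → Fin (s j) → W) →
             (∀ {j j′} → j < j′ → ∀ x y → R (f j x) (f j′ y)) →
             ∀ {j j′} → j ≢ j′ → ∀ x y → R (f j x) (f j′ y)
    across R-sym f R< {j} {j′} j≢j′ x y with <-cmp j j′
    ... | tri< j<j′ _ _ = R< j<j′ x y
    ... | tri≈ _ j≡j′ _ = ⊥-elim (j≢j′ j≡j′)
    ... | tri> _ _ j>j′ = R-sym (R< j>j′ y x)

    glue-injective : (f : ∀ j → Fin (s j) → W) → (∀ j → Injective _≡_ _≡_ (f j)) →
                     (∀ {j j′} → j ≢ j′ → ∀ x y → f j x ≢ f j′ y) →
                     Injective _≡_ _≡_ (λ (u : IUVertex s) → f (proj₁ u) (proj₂ u))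
    glue-injective f f-injective apart {j , x} {j′ , y} eq with j ≟ j′
    ... | yes refl = cong (j ,_) (f-injective j eq)
    ... | no j≢j′  = ⊥-elim (apart j≢j′ x y eq)

    inside⁻¹ : ∀ {j} {x y : Fin (s j)} → IUEdge s H (j , x) (j , y) → Edge (H j) x y
    inside⁻¹ (inside e) = e

    inside-component : ∀ {u v} → IUEdge s H u v → proj₁ u ≡ proj₁ v
    inside-component (inside _) = refl

    coEdge⇒≢ : ∀ {v w} → CoEdge G v w → v ≢ w
    coEdge⇒≢ (coEdge v≢w _) = v≢w

    coEdge⇒¬edge : ∀ {v w} → CoEdge G v w → ¬ Edge G v w
    coEdge⇒¬edge (coEdge _ ¬e) = ¬e

    ,-injectiveʳ : ∀ {j} {x y : Fin (s j)} → (IUVertex s ∋ (j , x)) ≡ (j , y) → x ≡ y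
    ,-injectiveʳ refl = refl

  isolatedUnion-embedding :
    (ι : ∀ j → InducedEmbedding (H j) G) →
    (∀ {j j′} → j < j′ → ∀ x y → CoEdge G (map (ι j) x) (map (ι j′) y)) →
    InducedEmbedding (IsolatedUnion s H) G
  isolatedUnion-embedding ι separated< = record
    { map       = φ
    ; injective = glue-injective (map ∘ ι) (injective ∘ ι)
                    (λ j≢j′ x y → coEdge⇒≢ (separated j≢j′ x y))
    ; edges     = λ u v → mk⇔ (to u v) (from u v)
    }
    where
    φ : IUVertex s → W
    φ (j , x) = map (ι j) x

    separated : ∀ {j j′} → j ≢ j′ → ∀ x y → CoEdge G (φ (j , x)) (φ (j′ , y))
    separated = across {R = CoEdge G} (sym (Complement G)) (map ∘ ι) separated<

    to : ∀ u v → IUEdge s H u v → Edge G (φ u) (φ v)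
    to _ _ (inside e) = Equivalence.to (edges (ι _) _ _) e

    from : ∀ u v → Edge G (φ u) (φ v) → IUEdge s H u v
    from (j , x) (j′ , y) e with j ≟ j′
    ... | yes refl = inside (Equivalence.from (edges (ι j) x y) e)
    ... | no j≢j′  = ⊥-elim (coEdge⇒¬edge (separated j≢j′ x y) e)

  complement-isolatedUnion-embedding :
    (ι : ∀ j → InducedEmbedding (Complement (H j)) G) →
    (∀ {j j′} → j < j′ → ∀ x y → Edge G (map (ι j) x) (map (ι j′) y)) →
    InducedEmbedding (Complement (IsolatedUnion s H)) G
  complement-isolatedUnion-embedding ι joined< = record
    { map       = φ
    ; injective = glue-injective (map ∘ ι) (injective ∘ ι)
                    (λ j≢j′ x y eq → irrefl G (subst (Edge G _) (≡.sym eq) (joined j≢j′ x y)))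
    ; edges     = λ u v → mk⇔ (to u v) (from u v)
    }
    where
    φ : IUVertex s → W
    φ (j , x) = map (ι j) x

    joined : ∀ {j j′} → j ≢ j′ → ∀ x y → Edge G (φ (j , x)) (φ (j′ , y))
    joined = across {R = Edge G} (sym G) (map ∘ ι) joined<

    to : ∀ u v → CoEdge (IsolatedUnion s H) u v → Edge G (φ u) (φ v)
    to (j , x) (j′ , y) (coEdge u≢v ¬e) with j ≟ j′
    ... | yes refl = Equivalence.to (edges (ι j) x y) (coEdge (u≢v ∘ cong (j ,_)) (¬e ∘ inside))
    ... | no j≢j′  = joined j≢j′ x y

    from : ∀ u v → Edge G (φ u) (φ v) → CoEdge (IsolatedUnion s H) u v
    from (j , x) (j′ , y) e with j ≟ j′
    ... | no j≢j′  = coEdge (j≢j′ ∘ cong proj₁) (j≢j′ ∘ inside-component)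
    ... | yes refl with Equivalence.from (edges (ι j) x y) e
    ...   | coEdge x≢y ¬e = coEdge (x≢y ∘ ,-injectiveʳ) (¬e ∘ inside⁻¹)

module Copies {W : Set} (G : Graph W) where

  infix 4 _↪_
  record _↪_ (A : AdjMatrix) (S : Pred W 0ℓ) : Set where
    field
      vertex           : Fin (size A) → W
      vertex∈          : ∀ x → S (vertex x)
      vertex-injective : Injective _≡_ _≡_ vertex
      adj⇔edge         : ∀ {x y} → x ≢ y → adj A x y ≡ true ⇔ Edge G (vertex x) (vertex y)
  open _↪_ public

  private
    variable
      S T : Pred W 0ℓ

  _∘⊑_ : A ↪ S → B ⊑ A → B ↪ S
  E ∘⊑ e = record
    { vertex           = vertex E ∘ pos e
    ; vertex∈          = vertex∈ E ∘ pos e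
    ; vertex-injective = λ eq → pos-injective e (vertex-injective E eq)
    ; adj⇔edge         = λ x≢y → subst (λ a → a ≡ true ⇔ _) (adj-pos e x≢y)
                                       (adj⇔edge E (x≢y ∘ pos-injective e))
    }

  retarget : (E : A ↪ S) → (∀ x → T (vertex E x)) → A ↪ T
  retarget E T∋ = record
    { vertex = vertex E ; vertex∈ = T∋ ; vertex-injective = vertex-injective E ; adj⇔edge = adj⇔edge E }

  ↪-mono : S ⊆ T → A ↪ S → A ↪ T
  ↪-mono S⊆T E = retarget E (λ x → S⊆T (vertex∈ E x))

  Universal : Pred W 0ℓ → Set
  Universal S = ∀ A → A ↪ S

  weaklyUniversal⇒universal : WeaklyUniversal G → Universal U
  weaklyUniversal⇒universal wu A = record
    { vertex           = map E
    ; vertex∈          = _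
    ; vertex-injective = injective E
    ; adj⇔edge         = λ x≢y → edges E _ _ ⇔-∘ mk⇔ (x≢y ,_) proj₂
    }
    where
    E = wu (size A) (graphOf A)

  Linked : Bool → W → W → Set
  Linked true  = Edge G
  Linked false = CoEdge G

  record LinkedCopies (A : ℕ → AdjMatrix) (colour : ℕ → Bool) : Set where
    field
      copy   : ∀ k → A k ↪ U
      linked : ∀ {k k′} → k < k′ → ∀ x y → Linked (colour k) (vertex (copy k) x) (vertex (copy k′) y)
  open LinkedCopies public

  reindex : {A B : ℕ → AdjMatrix} {c c′ : ℕ → Bool} {K : ℕ → ℕ} →
            LinkedCopies A c → K Preserves _<_ ⟶ _<_ →
            (∀ j → B j ⊑ A (K j)) → (∀ j → c (K j) ≡ c′ j) → LinkedCopies B c′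
  reindex L K↑ e c∘K≡c′ = record
    { copy   = λ j → copy L _ ∘⊑ e j
    ; linked = λ {j} j<j′ x y → subst (λ b → Linked b _ _) (c∘K≡c′ j) (linked L (K↑ j<j′) _ _)
    }

module Classical (lem : ExcludedMiddle 0ℓ) where

  ¬∃¬⇒∀ : {A : Set} {P : Pred A 0ℓ} → ¬ ∃ (∁ P) → ∀ x → P x
  ¬∃¬⇒∀ ¬∃ x = decidable-stable lem (λ ¬Px → ¬∃ (x , ¬Px))

  ¬∀⇒∃¬ : {A : Set} {P : Pred A 0ℓ} → ¬ (∀ x → P x) → ∃ (∁ P)
  ¬∀⇒∃¬ ¬∀ = decidable-stable lem (¬∀ ∘ ¬∃¬⇒∀)

  infinitelyOften-⊎ : {P Q : Pred ℕ 0ℓ} → (∀ k → P k ⊎ Q k) → InfinitelyOften P ⊎ InfinitelyOften Q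
  infinitelyOften-⊎ {P} {Q} P∪Q with lem {InfinitelyOften P}
  ... | yes infP = inj₁ infP
  ... | no ¬infP with ¬∀⇒∃¬ ¬infP
  ...   | m₀ , noneAfter = inj₂ λ m →
          m₀ + m , m≤n+m m m₀ ,
          fromInj₂ (λ Pk → ⊥-elim (noneAfter (m₀ + m , m≤m+n m₀ m , Pk))) (P∪Q (m₀ + m))

  monochromatic-subsequence : (c : ℕ → Bool) →
                              ∃₂ λ b K → K Preserves _<_ ⟶ _<_ × ∀ j → c (K j) ≡ b
  monochromatic-subsequence c with infinitelyOften-⊎ (true⊎false ∘ c)
  ... | inj₁ inf = true  , subsequence inf
  ... | inj₂ inf = false , subsequence inf

  matrixOf : FinGraph n → AdjMatrix
  matrixOf {n} F = record
    { size    = n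
    ; adj     = λ x y → does (lem {Edge F x y})
    ; adj-sym = λ x y → does-⇔ (mk⇔ (sym F) (sym F)) lem lem
    }

  module _ {W : Set} (G : Graph W) where
    open Copies G

    private
      variable
        S : Pred W 0ℓ

    toInducedEmbedding : {F : FinGraph n} → matrixOf F ↪ S → InducedEmbedding F G
    toInducedEmbedding {F = F} E = record
      { map = vertex E ; injective = vertex-injective E ; edges = edges′ }
      where
      edges′ : ∀ x y → Edge F x y ⇔ Edge G (vertex E x) (vertex E y)
      edges′ x y with x ≟ᶠ y
      ... | yes refl = mk⇔ (⊥-elim ∘ irrefl F) (⊥-elim ∘ irrefl G)
      ... | no x≢y   = adj⇔edge E x≢y ⇔-∘ ⇔-does lem

    lex-split : A [ B ] ↪ S → (P : Pred W 0ℓ) → B ↪ (S ∩ ∁ P) ⊎ A ↪ (S ∩ P)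
    lex-split {A} {B} E P with lem {∃ λ i → ∀ j → ¬ P (vertex E (combine i j))}
    ... | yes (i , avoids) =
      inj₁ (retarget (E ∘⊑ block i) (λ j → vertex∈ E _ , avoids j))
    ... | no ¬avoids =
      inj₂ (retarget (E ∘⊑ transversal (proj₁ ∘ meets)) (λ i → vertex∈ E _ , proj₂ (meets i)))
      where
      meets : ∀ i → ∃ λ j → P (vertex E (combine i j))
      meets = ¬∃¬⇒∀ (λ (i , ¬meets) → ¬avoids (i , ¬∃⟶∀¬ ¬meets))

    universal-split : Universal S → (P : Pred W 0ℓ) → Universal (S ∩ P) ⊎ Universal (S ∩ ∁ P)
    universal-split u P with lem {∃ λ A → ¬ A ↪ (_ ∩ P)}
    ... | yes (A , A-missing) = inj₂ λ B → fromInj₁ (⊥-elim ∘ A-missing) (lex-split (u (A [ B ])) P)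
    ... | no ¬missing         = inj₁ (¬∃¬⇒∀ ¬missing)

    universal-delete : Universal S → (v : W) → Universal (S ∩ ∁ ｛ v ｝)
    universal-delete {S} u v = fromInj₂ (⊥-elim ∘ ¬universal-singleton) (universal-split u ｛ v ｝)
      where
      ¬universal-singleton : ¬ Universal (S ∩ ｛ v ｝)
      ¬universal-singleton u₁ =
        0≢1+n (vertex-injective E (≡.trans (≡.sym (proj₂ (vertex∈ E zero)))
                                           (proj₂ (vertex∈ E (suc zero)))))
        where
        E = u₁ (edgeless 2)

    record Refinement (S : Pred W 0ℓ) {I : Set} (g : I → W) : Set₁ where
      field
        T         : Pred W 0ℓ
        universal : Universal T
        T⊆S       : T ⊆ S
        uniform   : ∀ i → ∃ λ b → T ⊆ Linked b (g i)
    open Refinement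

    refine-vertex : Universal S → (v : W) → Refinement S (λ (_ : ⊤) → v)
    refine-vertex {S} u v with universal-split (universal-delete u v) (Edge G v)
    ... | inj₁ u₁ = record
      { T = (S ∩ ∁ ｛ v ｝) ∩ Edge G v ; universal = u₁ ; T⊆S = proj₁ ∘ proj₁
      ; uniform = λ _ → true , proj₂ }
    ... | inj₂ u₂ = record
      { T = (S ∩ ∁ ｛ v ｝) ∩ ∁ (Edge G v) ; universal = u₂ ; T⊆S = proj₁ ∘ proj₁
      ; uniform = λ _ → false , λ ((_ , v≢t) , ¬e) → coEdge v≢t ¬e }

    refine : Universal S → (g : Fin N → W) → Refinement S g
    refine {S} {zero} u g = record { T = S ; universal = u ; T⊆S = id ; uniform = λ () }
    refine {S} {suc N} u g = record
      { T         = T R₀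
      ; universal = universal R₀
      ; T⊆S       = λ t → T⊆S R (T⊆S R₀ t)
      ; uniform   = λ { zero    → uniform R₀ tt
                      ; (suc i) → map₂ (λ l t → l (T⊆S R₀ t)) (uniform R i) }
      }
      where
      R  = refine u (g ∘ suc)
      R₀ = refine-vertex (universal R) (g zero)

    record Step (S : Pred W 0ℓ) (A : AdjMatrix) : Set₁ where
      field
        next           : Pred W 0ℓ
        next-universal : Universal next
        next⊆S         : next ⊆ S
        colour         : Bool
        copy           : A ↪ (S ∩ λ w → next ⊆ Linked colour w)

    step : Universal S → (A : AdjMatrix) → Step S A
    step {S} u A =
      [ stepWith false ∘ ↪-mono separated , stepWith true ∘ ↪-mono joined ] (lex-split E′ (LinkedTo true))
      where
      E = u (A [ A ])
      R = refine u (vertex E)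

      LinkedTo : Bool → Pred W 0ℓ
      LinkedTo b w = T R ⊆ Linked b w

      Uniform : Pred W 0ℓ
      Uniform w = ∃ λ b → LinkedTo b w

      E′ : A [ A ] ↪ (S ∩ Uniform)
      E′ = retarget E (λ k → vertex∈ E k , uniform R k)

      joined : (S ∩ Uniform) ∩ LinkedTo true ⊆ S ∩ LinkedTo true
      joined ((s , _) , l) = s , l

      separated : (S ∩ Uniform) ∩ ∁ (LinkedTo true) ⊆ S ∩ LinkedTo false
      separated ((s , true  , l) , ¬l) = ⊥-elim (¬l l)
      separated ((s , false , l) , _)  = s , l

      stepWith : (b : Bool) → A ↪ (S ∩ LinkedTo b) → Step S A
      stepWith b C = record
        { next = T R ; next-universal = universal R ; next⊆S = T⊆S R ; colour = b ; copy = C }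

    linkedCopies : Universal U → (A : ℕ → AdjMatrix) → ∃ (LinkedCopies A)
    linkedCopies u A = Step.colour ∘ step-at , record
      { copy   = λ k → ↪-mono _ (Step.copy (step-at k))
      ; linked = linked′
      }
      where
      stage : ℕ → ∃ Universal
      stage zero    = U , u
      stage (suc k) = Step.next σ , Step.next-universal σ
        where
        σ = step (proj₂ (stage k)) (A k)

      step-at : ∀ k → Step (proj₁ (stage k)) (A k)
      step-at k = step (proj₂ (stage k)) (A k)

      stage-antitone : ∀ {k k′} → k ≤′ k′ → proj₁ (stage k′) ⊆ proj₁ (stage k)
      stage-antitone ≤′-refl         = id
      stage-antitone (≤′-step k≤′k′) = λ t → stage-antitone k≤′k′ (Step.next⊆S (step-at _) t)

      linked′ : ∀ {k k′} → k < k′ → ∀ x y →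
                Linked (Step.colour (step-at k))
                       (vertex (Step.copy (step-at k)) x) (vertex (Step.copy (step-at k′)) y)
      linked′ {k} {k′} k<k′ x y =
        proj₂ (vertex∈ (Step.copy (step-at k)) x)
              (stage-antitone (≤⇒≤′ k<k′) (proj₁ (vertex∈ (Step.copy (step-at k′)) y)))

    homogeneousCopies : Universal U → (A : ℕ → AdjMatrix) → ∃ λ b → LinkedCopies A (const b)
    homogeneousCopies u A with linkedCopies u (partialSum A)
    ... | c , L with monochromatic-subsequence c
    ...   | b , K , K↑ , c∘K≡b = b , reindex L K↑ summand⊑ c∘K≡b
      where
      summand⊑ : ∀ j → A j ⊑ partialSum A (K j)
      summand⊑ j = ⊑-trans (summand⊑partialSum A j)
                           (partialSum-mono A (≤⇒≤′ (increasing⇒inflationary K↑ j)))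

theorem4p3 : ExcludedMiddle 0ℓ →
    (s : ℕ → ℕ) (H : (i : ℕ) → FinGraph (s i)) →
    ListsAllFinGraphsInfinitelyOften s H →
    {W : Set} (G : Graph W) → WeaklyUniversal G →
    InducedEmbedding (IsolatedUnion s H) G
      ⊎ InducedEmbedding (Complement (IsolatedUnion s H)) G
theorem4p3 lem s H _ G wu =
  fromHomogeneous (homogeneousCopies G (weaklyUniversal⇒universal wu) graphAndComplement)
  where
  open Copies G
  open Classical lem

  graphAndComplement : ℕ → AdjMatrix
  graphAndComplement j = matrixOf (H j) ⊕ matrixOf (Complement (H j))

  fromHomogeneous : (∃ λ b → LinkedCopies graphAndComplement (const b)) →
                    InducedEmbedding (IsolatedUnion s H) G
                      ⊎ InducedEmbedding (Complement (IsolatedUnion s H)) G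
  fromHomogeneous (false , L) =
    inj₁ (isolatedUnion-embedding (λ j → toInducedEmbedding G (copy L j ∘⊑ ⊕-left))
                                  (λ j<j′ _ _ → linked L j<j′ _ _))
  fromHomogeneous (true , L) =
    inj₂ (complement-isolatedUnion-embedding (λ j → toInducedEmbedding G (copy L j ∘⊑ ⊕-right))
                                             (λ j<j′ _ _ → linked L j<j′ _ _))
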